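{- Let $\sigma$ be a sign sequence and let $-\sigma$ be the sign sequence obtained from $\sigma$ by replacing every $+$ by $-$ and every $-$ by $+$ (and keeping each $0$). If $\sigma$ is good, then $-\sigma$ is good.
   Context: A sign sequence is a finite sequence of elements of $\mathbb Z_3$; we write $+$ for $1$ and $-$ for $2=-1$. A pattern is a cyclically ordered partition of $\{1,2,3,4\}$ into three parts, one of size 2 and two of size 1; patterns differing by a cyclic shift of parts are identical. Write $(xy|z|w)$ for the pattern $(\{x,y\},\{z\},\{w\})$. For a pattern $\pi=(xy|z|w)$: the patterns $+$-compatible with $\pi$ are $\pi$ itself and the two patterns obtained by moving one of $x,y$ into the part preceding $\{x,y\}$ in the cyclic order (i.e. into $\{w\}$); the patterns $0$-compatible with $\pi$ are $(zw|x|y)$ and $(zw|y|x)$. Let $D$ be the graph on the 12 patterns with an undirected edge $\pi\rho$ when $\rho$ is $0$-compatible with $\pi$ (a symmetric relation), and a directed edge (possibly a loop) from $\pi$ to $\rho$ when $\rho$ is $+$-compatible with $\pi$. For a sign sequence $\sigma=s_0\dots s_k$, a $\sigma$-stroll is a sequence $\pi_0\pi_1\dots\pi_{k+1}$ of patterns such that for each $0\le j\le k$: if $s_j=0$ then $\pi_j\pi_{j+1}$ is an undirected edge of $D$; if $s_j=1$ there is a directed edge (possibly a loop) from $\pi_j$ to $\pi_{j+1}$; if $s_j=-1$ there is a directed edge (possibly a loop) from $\pi_{j+1}$ to $\pi_j$. It goes from $\pi_0$ to $\pi_{k+1}$. The sequence $\sigma$ is good if there is a $\sigma$-stroll from $(12|3|4)$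 to $(12|4|3)$. -}

module Defs where

open import Data.Fin using (Fin; zero; suc)
open import Data.List using (List; []; _∷_; map)
open import Data.Product using (_×_; ∃-syntax)
open import Data.Sum using (_⊎_)
open import Relation.Binary.PropositionalEquality using (_≡_; _≢_)

-- Elements of ℤ₃: 0 ↦ 0, 1 ↦ + , 2 ↦ - (= -1).
Sign : Set
Sign = Fin 3

SignSeq : Set
SignSeq = List Sign

negS : Sign → Sign
negS zero = zero
negS (suc zero) = suc (suc zero)
negS (suc (suc zero)) = suc zero

negSeq : SignSeq → SignSeq
negSeq = map negS

-- A pattern (xy|z|w) on {1,2,3,4} (here Fin 4 = {0,1,2,3}) is determined by the
-- ordered pair (z , w) of distinct elements: the size-2 part is the complement
-- {x,y}, and the cyclic order is {x,y} → {z} → {w} → {x,y}.  Representing it with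
-- the size-2 part first removes the cyclic-shift ambiguity, so the 12 patterns
-- correspond bijectively to the 12 such pairs.
record Pattern : Set where
  constructor pat
  field
    z : Fin 4
    w : Fin 4
    z≢w : z ≢ w
open Pattern public

InPair : Fin 4 → Pattern → Set
InPair a π = (a ≢ z π) × (a ≢ w π)

-- ρ is 0-compatible with π = (xy|z|w): ρ = (zw|x|y) or (zw|y|x),
-- i.e. ρ's singletons are exactly π's pair part (in either order).
ZeroCompat : Pattern → Pattern → Set
ZeroCompat π ρ = InPair (z ρ) π × InPair (w ρ) π

-- ρ is +-compatible with π = (xy|z|w): ρ = π, or ρ is obtained by moving
-- a ∈ {x,y} into {w}, giving (w a | b | z) with {a,b} = {x,y}; i.e. ρ has
-- singletons z' = b ∈ {x,y} and w' = z.
SamePattern : Pattern → Pattern → Set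
SamePattern π ρ = (z π ≡ z ρ) × (w π ≡ w ρ)

PlusCompat : Pattern → Pattern → Set
PlusCompat π ρ = SamePattern π ρ ⊎ (InPair (z ρ) π × (w ρ ≡ z π))

Step : Sign → Pattern → Pattern → Set
Step zero π ρ = ZeroCompat π ρ
Step (suc zero) π ρ = PlusCompat π ρ
Step (suc (suc zero)) π ρ = PlusCompat ρ π

data Stroll : SignSeq → Pattern → Pattern → Set where
  nil  : ∀ {π ρ} → SamePattern π ρ → Stroll [] π ρ
  cons : ∀ {s σ π ρ τ} → Step s π ρ → Stroll σ ρ τ → Stroll (s ∷ σ) π τ

-- The patterns (12|3|4) and (12|4|3), with 1,2,3,4 ↦ 0,1,2,3.
p12|3|4 : Pattern
p12|3|4 = pat (suc (suc zero)) (suc (suc (suc zero))) (λ ())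

p12|4|3 : Pattern
p12|4|3 = pat (suc (suc (suc zero))) (suc (suc zero)) (λ ())

Good : SignSeq → Set
Good σ = Stroll σ p12|3|4 p12|4|3

module Submission where

open import Defs
open import Data.Fin using (zero; suc)
open import Data.Fin.Patterns using (2F; 3F)
open import Data.Fin.Permutation using (Permutation′; _⟨$⟩ʳ_; transpose)
open import Data.Product using (_,_; swap)
open import Data.Sum using (inj₁; inj₂)
open import Function using (_∘_; Injection)
open import Function.Properties.Inverse using (↔⇒↣)
open import Relation.Binary.PropositionalEquality using (_≡_; _≢_; sym; trans; cong)

-- Reading a pattern backwards, (xy|z|w) ↦ (xy|w|z), preserves 0-compatibility and
-- reverses +-compatibility, so it turns σ-strolls into (-σ)-strolls.  It sends
-- (12|3|4) to (12|4|3) and back, and relabelling by the transposition (3 4), which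
-- preserves both compatibilities, brings the endpoints back to where they were.

reverse : Pattern → Pattern
reverse π = pat (w π) (z π) (z≢w π ∘ sym)

ZeroCompat-reverse : ∀ {π ρ} → ZeroCompat π ρ → ZeroCompat (reverse π) (reverse ρ)
ZeroCompat-reverse (zρ∈π , wρ∈π) = swap wρ∈π , swap zρ∈π

PlusCompat-reverse : ∀ {π ρ} → PlusCompat π ρ → PlusCompat (reverse ρ) (reverse π)
PlusCompat-reverse (inj₁ (zπ≡zρ , wπ≡wρ)) = inj₁ (sym wπ≡wρ , sym zπ≡zρ)
PlusCompat-reverse {π} {ρ} (inj₂ ((_ , zρ≢wπ) , wρ≡zπ)) =
  inj₂ ((wπ≢wρ , zρ≢wπ ∘ sym) , sym wρ≡zπ)
  where
  wπ≢wρ : w π ≢ w ρ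
  wπ≢wρ wπ≡wρ = z≢w π (sym (trans wπ≡wρ wρ≡zπ))

Step-reverse : ∀ s {π ρ} → Step s π ρ → Step (negS s) (reverse π) (reverse ρ)
Step-reverse zero {π} {ρ} = ZeroCompat-reverse {π} {ρ}
Step-reverse (suc zero) {π} {ρ} = PlusCompat-reverse {π} {ρ}
Step-reverse (suc (suc zero)) {π} {ρ} = PlusCompat-reverse {ρ} {π}

Stroll-reverse : ∀ {σ π ρ} → Stroll σ π ρ → Stroll (negSeq σ) (reverse π) (reverse ρ)
Stroll-reverse (nil (zπ≡zρ , wπ≡wρ)) = nil (wπ≡wρ , zπ≡zρ)
Stroll-reverse (cons {s} step stroll) = cons (Step-reverse s step) (Stroll-reverse stroll)

module _ (f : Permutation′ 4) where

  private
    f-injective : ∀ {a b} → f ⟨$⟩ʳ a ≡ f ⟨$⟩ʳ b → a ≡ b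
    f-injective = Injection.injective (↔⇒↣ f)

  relabel : Pattern → Pattern
  relabel π = pat (f ⟨$⟩ʳ z π) (f ⟨$⟩ʳ w π) (z≢w π ∘ f-injective)

  InPair-relabel : ∀ a π → InPair a π → InPair (f ⟨$⟩ʳ a) (relabel π)
  InPair-relabel _ _ (a≢z , a≢w) = a≢z ∘ f-injective , a≢w ∘ f-injective

  SamePattern-relabel : ∀ {π ρ} → SamePattern π ρ → SamePattern (relabel π) (relabel ρ)
  SamePattern-relabel (zπ≡zρ , wπ≡wρ) = cong (f ⟨$⟩ʳ_) zπ≡zρ , cong (f ⟨$⟩ʳ_) wπ≡wρ

  ZeroCompat-relabel : ∀ {π ρ} → ZeroCompat π ρ → ZeroCompat (relabel π) (relabel ρ)
  ZeroCompat-relabel {π} {ρ} (zρ∈π , wρ∈π) =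
    InPair-relabel (z ρ) π zρ∈π , InPair-relabel (w ρ) π wρ∈π

  PlusCompat-relabel : ∀ {π ρ} → PlusCompat π ρ → PlusCompat (relabel π) (relabel ρ)
  PlusCompat-relabel {π} {ρ} (inj₁ same) = inj₁ (SamePattern-relabel {π} {ρ} same)
  PlusCompat-relabel {π} {ρ} (inj₂ (zρ∈π , wρ≡zπ)) =
    inj₂ (InPair-relabel (z ρ) π zρ∈π , cong (f ⟨$⟩ʳ_) wρ≡zπ)

  Step-relabel : ∀ s {π ρ} → Step s π ρ → Step s (relabel π) (relabel ρ)
  Step-relabel zero {π} {ρ} = ZeroCompat-relabel {π} {ρ}
  Step-relabel (suc zero) {π} {ρ} = PlusCompat-relabel {π} {ρ}
  Step-relabel (suc (suc zero)) {π} {ρ} = PlusCompat-relabel {ρ} {π}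

  Stroll-relabel : ∀ {σ π ρ} → Stroll σ π ρ → Stroll σ (relabel π) (relabel ρ)
  Stroll-relabel {π = π} {ρ} (nil same) = nil (SamePattern-relabel {π} {ρ} same)
  Stroll-relabel (cons {s} step stroll) = cons (Step-relabel s step) (Stroll-relabel stroll)

-- Proofs of a ≢ b are functions, so not definitionally unique; relabel (3 4) ∘ reverse
-- fixes (12|3|4) and (12|4|3) only up to this field, which Step and Stroll ignore.
Step-irrelevantˡ : ∀ s {a b ρ} {a≢b a≢b′ : a ≢ b} →
                   Step s (pat a b a≢b) ρ → Step s (pat a b a≢b′) ρ
Step-irrelevantˡ zero step = step
Step-irrelevantˡ (suc zero) step = step
Step-irrelevantˡ (suc (suc zero)) step = step

Stroll-irrelevantʳ : ∀ {σ π c d} {c≢d c≢d′ : c ≢ d} →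
                     Stroll σ π (pat c d c≢d) → Stroll σ π (pat c d c≢d′)
Stroll-irrelevantʳ (nil same) = nil same
Stroll-irrelevantʳ (cons step stroll) = cons step (Stroll-irrelevantʳ stroll)

Stroll-irrelevant : ∀ {σ a b c d} {a≢b a≢b′ : a ≢ b} {c≢d c≢d′ : c ≢ d} →
                    Stroll σ (pat a b a≢b) (pat c d c≢d) →
                    Stroll σ (pat a b a≢b′) (pat c d c≢d′)
Stroll-irrelevant (nil same) = nil same
Stroll-irrelevant (cons {s} step stroll) =
  cons (Step-irrelevantˡ s step) (Stroll-irrelevantʳ stroll)

lemma2p5 : (σ : SignSeq) → Good σ → Good (negSeq σ)
lemma2p5 σ good = Stroll-irrelevant (Stroll-relabel (transpose 2F 3F) (Stroll-reverse good))
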